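{- Let $\mathcal{A}$ be a visibly pushdown automaton with $m$ states. Then the $\Sigma$-diameter of $\mathcal{A}$ is at most $2^{m^2}$.
   Context: $\Sigma=\Sigma_+\cup\Sigma_-\cup\Sigma_=$ is a pushdown alphabet of push, pop and neutral symbols, and $\mathcal{A}=(Q,\Sigma,\Gamma,Q_{in},Q_f,\Delta)$ a visibly pushdown automaton with $\Delta\subseteq(Q\times\Sigma_+\times Q\times\Gamma)\cup(Q\times\Sigma_-\times\Gamma\times Q)\cup(Q\times\Sigma_=\times Q)$ (push symbols push a stack letter, pop symbols pop the top stack letter, neutral symbols leave the stack unchanged). A word is balanced if it has as many push as pop symbols and every prefix has at least as many push as pop symbols; for balanced $u$ write $p\to^u q$ if $\mathcal{A}$ can read $u$ from state $p$ to state $q$ with the stack unchanged. The $\Sigma$-diameter of $\mathcal{A}$ is the maximum, over all pairs $(p,q)\in Q^2$ for which some balanced $u\in\Sigma^*$ satisfies $p\to^u q$, of the minimal length of such a $u$. -}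

module Defs where

open import Data.Nat using (ℕ; zero; suc; _+_; _≤_)
open import Data.Fin using (Fin)
open import Data.Bool using (Bool; true; false; T)
open import Data.List using (List; []; _∷_; take; length)
open import Data.Product using (_×_; Σ-syntax)
open import Relation.Binary.PropositionalEquality using (_≡_)

-- The three kinds of letters of a pushdown alphabet Σ = Σ₊ ∪ Σ₋ ∪ Σ₌.
data Kind : Set where
  push pop neutral : Kind

record PushdownAlphabet : Set where
  field
    size : ℕ
    kind : Fin size → Kind

  Letter : Set
  Letter = Fin size

-- A visibly pushdown automaton with m states (Q = Fin m) and a finite stack
-- alphabet Γ = Fin g.
record VPA (Σ : PushdownAlphabet) (m : ℕ) : Set where
  open PushdownAlphabet Σ
  field
    g    : ℕ
    Qin  : Fin m → Bool
    Qf   : Fin m → Bool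
    -- (p, a, q, γ) ∈ Δ for a ∈ Σ₊ : read a, go p → q, push γ
    Δpush : Fin m → Letter → Fin m → Fin g → Bool
    -- (p, a, γ, q) ∈ Δ for a ∈ Σ₋ : read a, pop top letter γ, go p → q
    Δpop  : Fin m → Letter → Fin g → Fin m → Bool
    -- (p, a, q) ∈ Δ for a ∈ Σ₌ : read a, go p → q, stack unchanged
    Δneu  : Fin m → Letter → Fin m → Bool

module _ {Σ : PushdownAlphabet} where
  open PushdownAlphabet Σ

  countKind : Kind → List Letter → ℕ
  countKind k [] = 0
  countKind k (a ∷ u) with kind a | k
  ... | push    | push    = suc (countKind k u)
  ... | pop     | pop     = suc (countKind k u)
  ... | neutral | neutral = suc (countKind k u)
  ... | _       | _       = countKind k u

  Balanced : List Letter → Set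
  Balanced u = (countKind push u ≡ countKind pop u)
    × ((k : ℕ) → countKind pop (take k u) ≤ countKind push (take k u))

  module _ {m : ℕ} (A : VPA Σ m) where
    open VPA A

    -- Configurations: state and stack (head of the list = top of stack).
    -- Run p σ u q τ : A can read u from configuration (p, σ) to (q, τ).
    data Run : Fin m → List (Fin g) → List Letter → Fin m → List (Fin g) → Set where
      done : ∀ {p σ} → Run p σ [] p σ
      stepPush : ∀ {p σ a q γ u r τ} → kind a ≡ push →
                 T (Δpush p a q γ) → Run q (γ ∷ σ) u r τ → Run p σ (a ∷ u) r τ
      stepPop  : ∀ {p σ a q γ u r τ} → kind a ≡ pop →
                 T (Δpop p a γ q) → Run q σ u r τ → Run p (γ ∷ σ) (a ∷ u) r τ
      stepNeu  : ∀ {p σ a q u r τ} → kind a ≡ neutral →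
                 T (Δneu p a q) → Run q σ u r τ → Run p σ (a ∷ u) r τ

    -- p →^u q : u balanced and A reads u from p to q with the stack unchanged
    -- (taken with the empty stack; for balanced u this is equivalent to any stack).
    Reads : Fin m → List Letter → Fin m → Set
    Reads p u q = Balanced u × Run p [] u q []

    -- "Σ-diameter of A ≤ d": for every pair (p,q) admitting some balanced u
    -- with p →^u q, the minimal length of such u is ≤ d, i.e. some such u has
    -- length ≤ d.
    DiameterAtMost : ℕ → Set
    DiameterAtMost d = (p q : Fin m) (u : List Letter) → Reads p u q →
      Σ[ v ∈ List Letter ] (Reads p v q × length v ≤ d)

module Submission where

-- Call a pair of states (p , q) "summarised" when some word drives the
-- automaton from (p , empty stack) to (q , empty stack).  The summarised
-- pairs form the least relation that contains the identity and is closed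
-- under two extensions: appending a neutral letter, and appending a push
-- letter, a summarised run and a matching pop letter.
--
-- We compute this relation by iterating  saturate S = S ∪ (extensions of S)
-- from the identity, viewing relations as subsets of the m² pairs
-- (Sections 2 and 4):
--   * an inflationary operator on subsets of an n-element set, iterated from
--     a nonempty set, is stable after k < n rounds (Section 1);
--   * every pair of round k is realised by a word of length at most
--     2^(k+1) - 2, since each round at most doubles the length (Section 5);
--   * every reflexive relation closed under the extensions contains all pairs
--     joined by a run between empty stacks (Section 6).
-- So each summarised pair has a witness of length below 2^(m²); such words
-- are balanced because runs between empty stacks read balanced words
-- (Section 3), which is the diameter bound.

open import Defs
open import Data.Nat using (ℕ; _^_; _*_)
open import Data.Nat using (zero; suc; _+_; _≤_; _<_; z≤n; s≤s)
open import Data.Nat.Properties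
  using (≤-trans; ≤-reflexive; +-mono-≤; +-suc; m≤m+n; m≤n+m; <⇒≱; m<n⇒m<1+n; n<1+n; ^-monoʳ-≤)
open import Data.Nat.GeneralisedArithmetic using (fold)
open import Data.Nat.Tactic.RingSolver using (solve-∀)
open import Data.Fin using (Fin; combine; remQuot; _≟_)
open import Data.Fin.Properties using (any?; remQuot-combine)
open import Data.Fin.Subset using (Subset; _∈_; _⊆_; _∪_; ∣_∣; ⊥)
open import Data.Fin.Subset.Properties
  using (_∈?_; _⊂?_; ⊥⊆; ∉⊥; ∣⊥∣≡0; ∣p∣≤n; p⊂q⇒∣p∣<∣q∣; p⊆p∪q; x∈p∪q⁺; x∈p∪q⁻)
open import Data.Vec using (lookup; tabulate)
open import Data.Vec.Properties using (lookup∘tabulate; lookup⇒[]=; []=⇒lookup)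
open import Data.Bool using (T)
open import Data.Bool.Properties using (T-≡)
open import Data.List using (List; []; _∷_; _++_; take; length)
open import Data.List.Properties using (length-++)
open import Data.Product using (_×_; _,_; proj₁; proj₂; ∃-syntax)
open import Data.Sum using (_⊎_; inj₁; inj₂)
open import Function.Bundles using (Equivalence)
open import Relation.Nullary using (Dec; yes; no; does; contradiction)
open import Relation.Nullary.Decidable
  using (_×-dec_; _⊎-dec_; T?; dec-true; isYes≗does; toWitness; decidable-stable)
open import Relation.Binary.Definitions using (DecidableEquality)
open import Relation.Binary.PropositionalEquality
  using (_≡_; refl; sym; trans; cong; subst; module ≡-Reasoning)

-- Section 1.  Iterating an inflationary operator on subsets of Fin n.

nonempty⇒size>0 : ∀ {n} {S : Subset n} {x : Fin n} → x ∈ S → 0 < ∣ S ∣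
nonempty⇒size>0 {n} {S} x∈S =
  subst (_< ∣ S ∣) (∣⊥∣≡0 n) (p⊂q⇒∣p∣<∣q∣ (⊥⊆ , _ , x∈S , ∉⊥))

module Saturation {n : ℕ} (F : Subset n → Subset n) (inflationary : ∀ S → S ⊆ F S) where

  Stable : Subset n → Set
  Stable S = F S ⊆ S

  start⊆iterate : ∀ S₀ k → S₀ ⊆ fold S₀ F k
  start⊆iterate S₀ zero    x∈S₀ = x∈S₀
  start⊆iterate S₀ (suc k) x∈S₀ = inflationary _ (start⊆iterate S₀ k x∈S₀)

  stable-or-grows : ∀ S → Stable S ⊎ ∣ S ∣ < ∣ F S ∣
  stable-or-grows S with S ⊂? F S
  ... | yes S⊂FS = inj₂ (p⊂q⇒∣p∣<∣q∣ S⊂FS)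
  ... | no  S⊄FS = inj₁ λ {x} x∈FS →
    decidable-stable (x ∈? S) λ x∉S → S⊄FS (inflationary S , x , x∈FS , x∉S)

  stable-or-large : ∀ S₀ → 0 < ∣ S₀ ∣ → ∀ K →
    (∃[ k ] (k < K × Stable (fold S₀ F k))) ⊎ K < ∣ fold S₀ F K ∣
  stable-or-large S₀ nonempty zero = inj₂ nonempty
  stable-or-large S₀ nonempty (suc K) with stable-or-large S₀ nonempty K
  ... | inj₁ (k , k<K , stable) = inj₁ (k , m<n⇒m<1+n k<K , stable)
  ... | inj₂ large with stable-or-grows (fold S₀ F K)
  ...   | inj₁ stable = inj₁ (K , n<1+n K , stable)
  ...   | inj₂ grows  = inj₂ (≤-trans (s≤s large) grows)

  stabilises : ∀ S₀ → 0 < ∣ S₀ ∣ → ∃[ k ] (k < n × Stable (fold S₀ F k))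
  stabilises S₀ nonempty with stable-or-large S₀ nonempty n
  ... | inj₁ found    = found
  ... | inj₂ tooLarge = contradiction (∣p∣≤n (fold S₀ F n)) (<⇒≱ tooLarge)

-- Section 2.  Binary relations on Fin m as subsets of the m² pairs.

module Pairs (m : ℕ) where

  _∋_⇝_ : Subset (m * m) → Fin m → Fin m → Set
  R ∋ p ⇝ q = combine p q ∈ R

  relation : {P : Fin m → Fin m → Set} → (∀ p q → Dec (P p q)) → Subset (m * m)
  relation P? = tabulate λ i → let (p , q) = remQuot m i in does (P? p q)

  module _ {P : Fin m → Fin m → Set} (P? : ∀ p q → Dec (P p q)) {p q : Fin m} where

    lookup-relation : lookup (relation P?) (combine p q) ≡ does (P? p q)
    lookup-relation = begin
      lookup (relation P?) (combine p q)          ≡⟨ lookup∘tabulate _ (combine p q) ⟩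
      (let (p′ , q′) = remQuot m (combine p q) in does (P? p′ q′))
        ≡⟨ cong (λ (p′ , q′) → does (P? p′ q′)) (remQuot-combine p q) ⟩
      does (P? p q)                               ∎
      where open ≡-Reasoning

    ∈-relation⁺ : P p q → relation P? ∋ p ⇝ q
    ∈-relation⁺ pq = lookup⇒[]= _ _ (trans lookup-relation (dec-true (P? p q) pq))

    ∈-relation⁻ : relation P? ∋ p ⇝ q → P p q
    ∈-relation⁻ r = toWitness (Equivalence.from T-≡
      (trans (isYes≗does (P? p q)) (trans (sym lookup-relation) ([]=⇒lookup r))))

  identity : Subset (m * m)
  identity = relation _≟_

-- Arithmetic of the length bounds in Section 5: one or two words of length
-- at most B - 2, together with one or two new letters, fit into the bound 2B.
≤-double : ∀ {x y B} → x ≤ B → y ≤ B → x + y ≤ 2 * B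
≤-double {x} {y} {B} x≤B y≤B = subst (x + y ≤_) (double B) (+-mono-≤ x≤B y≤B)
  where
    double : ∀ B → B + B ≡ 2 * B
    double = solve-∀

append-one-bound : ∀ {L B} → L + 2 ≤ B → L + 1 + 2 ≤ 2 * B
append-one-bound {L} {B} L+2≤B = subst (_≤ 2 * B) (reshape L) (≤-double L+2≤B 1≤B)
  where
    1≤B : 1 ≤ B
    1≤B = ≤-trans (s≤s z≤n) (≤-trans (m≤n+m 2 L) L+2≤B)
    reshape : ∀ L → (L + 2) + 1 ≡ L + 1 + 2
    reshape = solve-∀

append-matched-bound : ∀ {L₁ L₂ B} → L₁ + 2 ≤ B → L₂ + 2 ≤ B →
  L₁ + suc (L₂ + 1) + 2 ≤ 2 * B
append-matched-bound {L₁} {L₂} {B} h₁ h₂ =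
  subst (_≤ 2 * B) (reshape L₁ L₂) (≤-double h₁ h₂)
  where
    reshape : ∀ L₁ L₂ → (L₁ + 2) + (L₂ + 2) ≡ L₁ + suc (L₂ + 1) + 2
    reshape = solve-∀

-- Section 3.  Runs of a visibly pushdown automaton.

module Runs {Σ : PushdownAlphabet} {m : ℕ} (A : VPA Σ m) where
  open PushdownAlphabet Σ
  open VPA A

  #push #pop : List Letter → ℕ
  #push = countKind {Σ} push
  #pop  = countKind {Σ} pop

  count-push : ∀ {a} u → kind a ≡ push →
    #push (a ∷ u) ≡ suc (#push u) × #pop (a ∷ u) ≡ #pop u
  count-push u isPush rewrite isPush = refl , refl

  count-pop : ∀ {a} u → kind a ≡ pop →
    #push (a ∷ u) ≡ #push u × #pop (a ∷ u) ≡ suc (#pop u)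
  count-pop u isPop rewrite isPop = refl , refl

  count-neutral : ∀ {a} u → kind a ≡ neutral →
    #push (a ∷ u) ≡ #push u × #pop (a ∷ u) ≡ #pop u
  count-neutral u isNeutral rewrite isNeutral = refl , refl

  -- Stack height bookkeeping: pushes raise and pops lower the stack by one,
  -- so initial height plus pushes equals final height plus pops.
  run-height : ∀ {p σ u q τ} → Run A p σ u q τ → length σ + #push u ≡ length τ + #pop u
  run-height done = refl
  run-height {σ = σ} {τ = τ} (stepPush {a = a} {u = u} isPush _ r) = begin
    length σ + #push (a ∷ u)  ≡⟨ cong (length σ +_) (proj₁ (count-push u isPush)) ⟩
    length σ + suc (#push u)  ≡⟨ +-suc (length σ) (#push u) ⟩
    suc (length σ) + #push u  ≡⟨ run-height r ⟩
    length τ + #pop u         ≡⟨ cong (length τ +_) (proj₂ (count-push u isPush)) ⟨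
    length τ + #pop (a ∷ u)   ∎
    where open ≡-Reasoning
  run-height {σ = γ ∷ σ} {τ = τ} (stepPop {a = a} {u = u} isPop _ r) = begin
    suc (length σ) + #push (a ∷ u) ≡⟨ cong (suc (length σ) +_) (proj₁ (count-pop u isPop)) ⟩
    suc (length σ + #push u)       ≡⟨ cong suc (run-height r) ⟩
    suc (length τ + #pop u)        ≡⟨ +-suc (length τ) (#pop u) ⟨
    length τ + suc (#pop u)        ≡⟨ cong (length τ +_) (proj₂ (count-pop u isPop)) ⟨
    length τ + #pop (a ∷ u)        ∎
    where open ≡-Reasoning
  run-height {σ = σ} {τ = τ} (stepNeu {a = a} {u = u} isNeutral _ r) = begin
    length σ + #push (a ∷ u)  ≡⟨ cong (length σ +_) (proj₁ (count-neutral u isNeutral)) ⟩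
    length σ + #push u        ≡⟨ run-height r ⟩
    length τ + #pop u         ≡⟨ cong (length τ +_) (proj₂ (count-neutral u isNeutral)) ⟨
    length τ + #pop (a ∷ u)   ∎
    where open ≡-Reasoning

  run-prefix : ∀ {p σ u q τ} → Run A p σ u q τ →
    ∀ n → ∃[ r ] ∃[ ρ ] Run A p σ (take n u) r ρ
  run-prefix r                   zero    = _ , _ , done
  run-prefix done                (suc n) = _ , _ , done
  run-prefix (stepPush isPush δ r) (suc n) with run-prefix r n
  ... | _ , _ , r′ = _ , _ , stepPush isPush δ r′
  run-prefix (stepPop isPop δ r) (suc n) with run-prefix r n
  ... | _ , _ , r′ = _ , _ , stepPop isPop δ r′
  run-prefix (stepNeu isNeutral δ r) (suc n) with run-prefix r n
  ... | _ , _ , r′ = _ , _ , stepNeu isNeutral δ r′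

  -- A word read from empty stack to empty stack is balanced: the height
  -- equation gives equal counts, and applied to prefixes (starting from the
  -- empty stack) it bounds pops by pushes.
  run-balanced : ∀ {p u q} → Run A p [] u q [] → Balanced u
  run-balanced {u = u} r = run-height r , pops≤pushes
    where
      pops≤pushes : ∀ n → #pop (take n u) ≤ #push (take n u)
      pops≤pushes n with run-prefix r n
      ... | _ , ρ , r′ = ≤-trans (m≤n+m _ (length ρ)) (≤-reflexive (sym (run-height r′)))

  run-++ : ∀ {p σ u q τ w r ρ} → Run A p σ u q τ → Run A q τ w r ρ → Run A p σ (u ++ w) r ρ
  run-++ done                   r′ = r′
  run-++ (stepPush isPush δ r)   r′ = stepPush isPush δ (run-++ r r′)
  run-++ (stepPop isPop δ r)     r′ = stepPop isPop δ (run-++ r r′)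
  run-++ (stepNeu isNeutral δ r) r′ = stepNeu isNeutral δ (run-++ r r′)

  run-below : ∀ {p σ u q τ} ρ → Run A p σ u q τ → Run A p (σ ++ ρ) u q (τ ++ ρ)
  run-below ρ done                   = done
  run-below ρ (stepPush isPush δ r)   = stepPush isPush δ (run-below ρ r)
  run-below ρ (stepPop isPop δ r)     = stepPop isPop δ (run-below ρ r)
  run-below ρ (stepNeu isNeutral δ r) = stepNeu isNeutral δ (run-below ρ r)

-- Section 4.  Summary relations and their one-step extensions.

_≟ᵏ_ : DecidableEquality Kind
push    ≟ᵏ push    = yes refl
pop     ≟ᵏ pop     = yes refl
neutral ≟ᵏ neutral = yes refl
push    ≟ᵏ pop     = no λ ()
push    ≟ᵏ neutral = no λ ()
pop     ≟ᵏ push    = no λ ()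
pop     ≟ᵏ neutral = no λ ()
neutral ≟ᵏ push    = no λ ()
neutral ≟ᵏ pop     = no λ ()

module Summaries {Σ : PushdownAlphabet} {m : ℕ} (A : VPA Σ m) where
  open PushdownAlphabet Σ
  open VPA A
  open Pairs m
  open Runs A

  NeutralExtension : Subset (m * m) → Fin m → Fin m → Set
  NeutralExtension S p q =
    ∃[ r ] ∃[ a ] (S ∋ p ⇝ r × kind a ≡ neutral × T (Δneu r a q))

  MatchedExtension : Subset (m * m) → Fin m → Fin m → Set
  MatchedExtension S p q =
    ∃[ s ] ∃[ a ] ∃[ t ] ∃[ γ ] ∃[ t′ ] ∃[ b ]
      (S ∋ p ⇝ s × kind a ≡ push × T (Δpush s a t γ) ×
       S ∋ t ⇝ t′ × kind b ≡ pop  × T (Δpop t′ b γ q))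

  Extension : Subset (m * m) → Fin m → Fin m → Set
  Extension S p q = NeutralExtension S p q ⊎ MatchedExtension S p q

  extension? : ∀ S p q → Dec (Extension S p q)
  extension? S p q = neutral? ⊎-dec matched?
    where
      neutral? : Dec (NeutralExtension S p q)
      neutral? = any? λ r → any? λ a →
        (combine p r ∈? S) ×-dec (kind a ≟ᵏ neutral) ×-dec T? (Δneu r a q)
      matched? : Dec (MatchedExtension S p q)
      matched? = any? λ s → any? λ a → any? λ t → any? λ γ → any? λ t′ → any? λ b →
        (combine p s ∈? S) ×-dec (kind a ≟ᵏ push) ×-dec T? (Δpush s a t γ) ×-dec
        (combine t t′ ∈? S) ×-dec (kind b ≟ᵏ pop) ×-dec T? (Δpop t′ b γ q)

  saturate : Subset (m * m) → Subset (m * m)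
  saturate S = S ∪ relation (extension? S)

  round : ℕ → Subset (m * m)
  round = fold identity saturate

  open Saturation saturate (λ S → p⊆p∪q _)

  round-reflexive : ∀ k p → round k ∋ p ⇝ p
  round-reflexive k p = start⊆iterate identity k (∈-relation⁺ _≟_ refl)

  round-stabilises : Fin m → ∃[ k ] (k < m * m × Stable (round k))
  round-stabilises p = stabilises identity (nonempty⇒size>0 (round-reflexive 0 p))

  stable-closed : ∀ {S} → Stable S → ∀ {p q} → Extension S p q → S ∋ p ⇝ q
  stable-closed stable e = stable (x∈p∪q⁺ (inj₂ (∈-relation⁺ (extension? _) e)))

  -- Section 5.  Soundness: pairs in round k are realised by short words.

  RunWithin : ℕ → Fin m → Fin m → Set
  RunWithin B p q = ∃[ v ] (Run A p [] v q [] × length v + 2 ≤ B)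

  extension-within : ∀ {S B p q} → (∀ {p′ q′} → S ∋ p′ ⇝ q′ → RunWithin B p′ q′) →
    Extension S p q → RunWithin (2 * B) p q
  extension-within short (inj₁ (r , a , pr , isNeutral , δ)) with short pr
  ... | v , run , bound =
    v ++ a ∷ [] ,
    run-++ run (stepNeu isNeutral δ done) ,
    subst (λ L → L + 2 ≤ _) (sym (length-++ v)) (append-one-bound bound)
  extension-within short (inj₂ (s , a , t , γ , t′ , b , ps , isPush , δ₊ , tt′ , isPop , δ₋))
    with short ps | short tt′
  ... | v₁ , run₁ , bound₁ | v₂ , run₂ , bound₂ =
    v₁ ++ a ∷ (v₂ ++ b ∷ []) ,
    run-++ run₁ (stepPush isPush δ₊
      (run-++ (run-below (γ ∷ []) run₂) (stepPop isPop δ₋ done))) ,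
    subst (λ L → L + 2 ≤ _)
      (sym (trans (length-++ v₁) (cong (λ L → length v₁ + suc L) (length-++ v₂))))
      (append-matched-bound bound₁ bound₂)

  -- Round k is realised within 2^(k+1): each round at most doubles the bound.
  round-sound : ∀ k {p q} → round k ∋ p ⇝ q → RunWithin (2 ^ suc k) p q
  round-sound zero {p} {q} r with ∈-relation⁻ _≟_ {p} {q} r
  ... | refl = [] , done , s≤s (s≤s z≤n)
  round-sound (suc k) r with x∈p∪q⁻ (round k) _ r
  ... | inj₁ old with round-sound k old
  ...   | v , run , bound = v , run , ≤-trans bound (m≤m+n _ _)
  round-sound (suc k) r | inj₂ new =
    extension-within (round-sound k) (∈-relation⁻ (extension? (round k)) new)

  -- Section 6.  Completeness: closed reflexive relations contain all summaries.

  module Completeness (S : Subset (m * m))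
    (closed : ∀ {p q} → Extension S p q → S ∋ p ⇝ q)
    (reflexive : ∀ p → S ∋ p ⇝ p) where

    -- Pending p₀ σ p: the configuration (p , σ) is reached from (p₀ , ε), and
    -- the run decomposes along the unmatched pushes that produced σ into
    -- S-summarised pieces.
    data Pending (p₀ : Fin m) : List (Fin g) → Fin m → Set where
      bottom : ∀ {p} → S ∋ p₀ ⇝ p → Pending p₀ [] p
      pushed : ∀ {σ s a t γ p} → Pending p₀ σ s → kind a ≡ push → T (Δpush s a t γ) →
               S ∋ t ⇝ p → Pending p₀ (γ ∷ σ) p

    extend-top : ∀ {p₀ σ p q} → Pending p₀ σ p →
      (∀ {x} → S ∋ x ⇝ p → S ∋ x ⇝ q) → Pending p₀ σ q
    extend-top (bottom h)            f = bottom (f h)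
    extend-top (pushed P isPush δ h) f = pushed P isPush δ (f h)

    -- Follow the run: a push opens a new (trivially summarised) piece, a
    -- neutral letter extends the top piece, and a pop closes the top piece,
    -- merging it with the piece below by a matched extension.
    complete-from : ∀ {p₀ p σ u q} → Run A p σ u q [] → Pending p₀ σ p → S ∋ p₀ ⇝ q
    complete-from done (bottom h) = h
    complete-from (stepPush isPush δ r) P =
      complete-from r (pushed P isPush δ (reflexive _))
    complete-from (stepNeu isNeutral δ r) P =
      complete-from r (extend-top P λ h → closed (inj₁ (_ , _ , h , isNeutral , δ)))
    complete-from (stepPop isPop δ₋ r) (pushed P isPush δ₊ h) =
      complete-from r (extend-top P λ h′ →
        closed (inj₂ (_ , _ , _ , _ , _ , _ , h′ , isPush , δ₊ , h , isPop , δ₋)))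

    complete : ∀ {p u q} → Run A p [] u q [] → S ∋ p ⇝ q
    complete r = complete-from r (bottom (reflexive _))


fact21 : (Σ : PushdownAlphabet) (m : ℕ) (A : VPA Σ m) → DiameterAtMost A (2 ^ (m * m))
fact21 Σ m A p q u (_ , run) =
  let open Runs A
      open Summaries A
      (k , k<m² , stable) = round-stabilises p
      (v , run′ , short) = round-sound k
        (Completeness.complete (round k) (stable-closed stable) (round-reflexive k) run)
  in v , (run-balanced run′ , run′) ,
     ≤-trans (m≤m+n (length v) 2) (≤-trans short (^-monoʳ-≤ 2 k<m²))
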